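{- Let $G$ be a triangle-free graph on $n$ vertices with minimum degree $\delta$. Then for every subset $T \subset V(G)$ such that no two vertices of $T$ are at distance exactly $2$ in $G$, we have $n \geq 2\left\lceil \frac{\delta |T|}{2}\right\rceil$.
   Context: Graphs are finite and simple; $d$ denotes graph distance. -}

module Defs where

open import Data.Nat using (ℕ; _*_; _≤_; ⌈_/2⌉)
open import Data.Fin using (Fin)
open import Data.Fin.Subset using (Subset; _∈_; ∣_∣)
open import Data.Bool using (Bool; true; false)
open import Data.Vec using (tabulate)
open import Data.Product using (_×_; ∃-syntax)
open import Relation.Binary.PropositionalEquality using (_≡_)
open import Relation.Nullary using (¬_)
open import Data.Empty using (⊥)

record Graph (n : ℕ) : Set where
  field
    adj     : Fin n → Fin n → Bool
    sym     : ∀ u v → adj u v ≡ adj v u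
    irrefl  : ∀ v → adj v v ≡ false

module _ {n : ℕ} (G : Graph n) where
  open Graph G

  Adj : Fin n → Fin n → Set
  Adj u v = adj u v ≡ true

  N : Fin n → Subset n
  N v = tabulate (adj v)

  degree : Fin n → ℕ
  degree v = ∣ N v ∣

  MinDegree : ℕ → Set
  MinDegree δ = (∀ v → δ ≤ degree v) × ∃[ v ] (degree v ≡ δ)

  TriangleFree : Set
  TriangleFree = ∀ u v w → Adj u v → Adj v w → Adj u w → ⊥

  Dist2 : Fin n → Fin n → Set
  Dist2 u v = ¬ (u ≡ v) × ¬ Adj u v × ∃[ w ] (Adj u w × Adj w v)

  NoDist2 : Subset n → Set
  NoDist2 T = ∀ u v → u ∈ T → v ∈ T → ¬ Dist2 u v

-- The neighbourhoods of the vertices of T are pairwise disjoint, since two vertices of T with a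
-- common neighbour would span a triangle or be at distance 2.  So the vertices with a neighbour
-- in T number Σ_{t ∈ T} deg t ≥ δ |T|, and they miss every vertex of T with no neighbour in T.
-- The remaining vertices of T are perfectly matched inside T: if they are all of T, then |T| and
-- hence δ |T| is even and δ |T| ≤ n; otherwise δ |T| ≤ n - 1.

module Submission where

open import Defs
open import Data.Bool using (Bool; true; false; _∧_)
open import Data.Bool.Properties using (not-¬)
open import Data.Empty using (⊥-elim)
open import Data.Fin using (Fin; zero; suc; _≟_)
open import Data.Fin.Properties using (suc-injective)
open import Data.Fin.Subset using (Subset; ∣_∣)
open import Data.Nat using (ℕ; zero; suc; _+_; _*_; _≤_; z≤n; s≤s; ⌈_/2⌉)
open import Data.Nat.Divisibility using (_∣_; divides; ∣m∣n⇒∣m+n; m∣m*n; ∣n⇒∣m*n)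
open import Data.Nat.Properties hiding (_≟_; suc-injective)
open import Algebra.Properties.Semiring.Sum +-*-semiring
  using (sum-syntax; sum-cong-≗; sum-replicate-zero; ∑-distrib-+; ∑-comm; *-distribˡ-sum)
open import Data.Product using (_×_; _,_)
open import Data.Sum using (inj₁; inj₂)
open import Data.Vec using ([]; _∷_; lookup; tabulate)
open import Data.Vec.Properties using (lookup∘tabulate; lookup⇒[]=)
open import Function using (_∘_)
open import Relation.Binary.PropositionalEquality
open import Relation.Nullary using (yes; no)

toℕ : Bool → ℕ
toℕ false = 0
toℕ true  = 1

toℕ-∧ : ∀ x y → toℕ (x ∧ y) ≡ toℕ x * toℕ y
toℕ-∧ false y = refl
toℕ-∧ true  y = sym (+-identityʳ (toℕ y))

∧-true : ∀ {x y} → x ∧ y ≡ true → x ≡ true × y ≡ true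
∧-true {true} {true} refl = refl , refl

∑-mono-≤ : ∀ {n} {f g : Fin n → ℕ} → (∀ i → f i ≤ g i) → ∑[ i < n ] f i ≤ ∑[ i < n ] g i
∑-mono-≤ {zero}  f≤g = z≤n
∑-mono-≤ {suc n} f≤g = +-mono-≤ (f≤g zero) (∑-mono-≤ (f≤g ∘ suc))

∑-one : ∀ n → ∑[ i < n ] 1 ≡ n
∑-one zero    = refl
∑-one (suc n) = cong suc (∑-one n)

∣p∣≡∑toℕ : ∀ {n} (p : Subset n) → ∣ p ∣ ≡ ∑[ i < n ] toℕ (lookup p i)
∣p∣≡∑toℕ []          = refl
∣p∣≡∑toℕ (true  ∷ p) = cong suc (∣p∣≡∑toℕ p)
∣p∣≡∑toℕ (false ∷ p) = ∣p∣≡∑toℕ p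

∣tabulate∣≡∑toℕ : ∀ {n} (f : Fin n → Bool) → ∣ tabulate f ∣ ≡ ∑[ i < n ] toℕ (f i)
∣tabulate∣≡∑toℕ f = trans (∣p∣≡∑toℕ (tabulate f)) (sum-cong-≗ (cong toℕ ∘ lookup∘tabulate f))

x+toℕb≤1+toℕb*x : ∀ b {x} → x ≤ 1 → x + toℕ b ≤ 1 + toℕ b * x
x+toℕb≤1+toℕb*x false {x} x≤1 = ≤-trans (≤-reflexive (+-identityʳ x)) x≤1
x+toℕb≤1+toℕb*x true  {x} _   = ≤-reflexive (trans (+-comm x 1) (cong suc (sym (+-identityʳ x))))

∑toℕ≤1 : ∀ {n} (p : Fin n → Bool) → (∀ i j → p i ≡ true → p j ≡ true → i ≡ j) →
         ∑[ i < n ] toℕ (p i) ≤ 1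
∑toℕ≤1 {zero}  p unique = z≤n
∑toℕ≤1 {suc n} p unique with p zero in p₀
... | false = ∑toℕ≤1 (p ∘ suc) (λ i j pᵢ pⱼ → suc-injective (unique (suc i) (suc j) pᵢ pⱼ))
... | true  = ≤-reflexive (cong suc (trans (sum-cong-≗ tail-false) (sum-replicate-zero n)))
  where
  tail-false : ∀ i → toℕ (p (suc i)) ≡ 0
  tail-false i with p (suc i) in pᵢ
  ... | false = refl
  ... | true  with () ← unique zero (suc i) p₀ pᵢ

2∣∑-symmetric : ∀ {n} (a : Fin n → Fin n → ℕ) → (∀ i j → a i j ≡ a j i) → (∀ i → a i i ≡ 0) →
                2 ∣ ∑[ i < n ] ∑[ j < n ] a i j
2∣∑-symmetric {zero}  a symm diag = divides 0 refl
2∣∑-symmetric {suc n} a symm diag =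
  subst (2 ∣_) (sym split) (∣m∣n⇒∣m+n (m∣m*n X) (2∣∑-symmetric (λ i j → a (suc i) (suc j))
                                                  (λ i j → symm (suc i) (suc j)) (diag ∘ suc)))
  where
  open ≡-Reasoning
  X = ∑[ j < n ] a zero (suc j)
  R = ∑[ i < n ] ∑[ j < n ] a (suc i) (suc j)
  split : ∑[ i < suc n ] ∑[ j < suc n ] a i j ≡ 2 * X + R
  split = begin
    (a zero zero + X) + ∑[ i < n ] (a (suc i) zero + ∑[ j < n ] a (suc i) (suc j))
      ≡⟨ cong₂ _+_ (cong (_+ X) (diag zero)) (∑-distrib-+ (λ i → a (suc i) zero) _) ⟩
    X + (∑[ i < n ] a (suc i) zero + R)
      ≡⟨ cong (λ Y → X + (Y + R)) (sum-cong-≗ (λ i → symm (suc i) zero)) ⟩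
    X + (X + R)
      ≡⟨ sym (+-assoc X X R) ⟩
    X + X + R
      ≡⟨ cong (λ Y → X + Y + R) (sym (+-identityʳ X)) ⟩
    2 * X + R ∎

2*⌈m/2⌉≤1+m : ∀ m → 2 * ⌈ m /2⌉ ≤ suc m
2*⌈m/2⌉≤1+m zero          = z≤n
2*⌈m/2⌉≤1+m (suc zero)    = ≤-refl
2*⌈m/2⌉≤1+m (suc (suc m)) = ≤-trans (≤-reflexive (*-distribˡ-+ 2 1 ⌈ m /2⌉)) (s≤s (s≤s (2*⌈m/2⌉≤1+m m)))

2∣m⇒2*⌈m/2⌉≡m : ∀ {m} → 2 ∣ m → 2 * ⌈ m /2⌉ ≡ m
2∣m⇒2*⌈m/2⌉≡m (divides q refl) = begin
  2 * ⌈ q * 2 /2⌉     ≡⟨ cong (λ m → 2 * ⌈ m /2⌉) (*-comm q 2) ⟩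
  2 * ⌈ 2 * q /2⌉     ≡⟨ cong (λ m → 2 * ⌈ q + m /2⌉) (+-identityʳ q) ⟩
  2 * ⌈ q + q /2⌉     ≡⟨ cong (2 *_) (sym (n≡⌈n+n/2⌉ q)) ⟩
  2 * q               ≡⟨ *-comm 2 q ⟩
  q * 2               ∎
  where open ≡-Reasoning

-- With e = t the parity of e is that of t, hence of δ t; with e < t there is one unit to spare.
2*⌈δt/2⌉≤n : ∀ δ t e n → δ * t + t ≤ n + e → e ≤ t → 2 ∣ e → 2 * ⌈ δ * t /2⌉ ≤ n
2*⌈δt/2⌉≤n δ t e n δt+t≤n+e e≤t 2∣e with m≤n⇒m<n∨m≡n e≤t
... | inj₁ e<t = ≤-trans (2*⌈m/2⌉≤1+m (δ * t)) (+-cancelʳ-≤ t (suc (δ * t)) n (begin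
  suc (δ * t + t)   ≤⟨ s≤s δt+t≤n+e ⟩
  suc (n + e)       ≡⟨ +-suc n e ⟨
  n + suc e         ≤⟨ +-monoʳ-≤ n e<t ⟩
  n + t             ∎))
  where open ≤-Reasoning
... | inj₂ refl = ≤-trans (≤-reflexive (2∣m⇒2*⌈m/2⌉≡m (∣n⇒∣m*n δ 2∣e))) (+-cancelʳ-≤ e (δ * e) n δt+t≤n+e)

module _ {n} (G : Graph n) (T : Subset n) where
  open Graph G renaming (sym to adj-sym)

  inT : Fin n → ℕ
  inT t = toℕ (lookup T t)

  edge : Fin n → Fin n → ℕ
  edge u v = toℕ (adj u v)

  degreeIn : Fin n → ℕ
  degreeIn v = ∑[ t < n ] (inT t * edge t v)

  -- Twice the number of edges with both ends in T.
  innerDegreeSum : ℕ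
  innerDegreeSum = ∑[ v < n ] (inT v * degreeIn v)

  -- Two distinct vertices of T with a common neighbour are adjacent (a triangle) or at distance 2.
  degreeIn≤1 : TriangleFree G → NoDist2 G T → ∀ v → degreeIn v ≤ 1
  degreeIn≤1 triangleFree noDist2 v =
    subst (_≤ 1) (sum-cong-≗ (λ t → toℕ-∧ (lookup T t) (adj t v)))
          (∑toℕ≤1 (λ t → lookup T t ∧ adj t v) unique)
    where
    unique : ∀ t t′ → lookup T t ∧ adj t v ≡ true → lookup T t′ ∧ adj t′ v ≡ true → t ≡ t′
    unique t t′ tv t′v with ∧-true tv | ∧-true t′v | t ≟ t′
    ... | _ , _ | _ , _ | yes t≡t′ = t≡t′
    ... | t∈T , t~v | t′∈T , t′~v | no t≢t′ with adj t t′ in t~t′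
    ...   | true  = ⊥-elim (triangleFree t t′ v t~t′ t′~v t~v)
    ...   | false = ⊥-elim (noDist2 t t′ (lookup⇒[]= t T t∈T) (lookup⇒[]= t′ T t′∈T)
                      (t≢t′ , not-¬ t~t′ , v , t~v , trans (adj-sym v t′) t′~v))

  ∑degreeIn≡∑inT*degree : ∑[ v < n ] degreeIn v ≡ ∑[ t < n ] (inT t * degree G t)
  ∑degreeIn≡∑inT*degree = begin
    ∑[ v < n ] ∑[ t < n ] (inT t * edge t v) ≡⟨ ∑-comm (λ v t → inT t * edge t v) ⟩
    ∑[ t < n ] ∑[ v < n ] (inT t * edge t v) ≡⟨ sum-cong-≗ (λ t → sym (*-distribˡ-sum (inT t) (edge t))) ⟩
    ∑[ t < n ] (inT t * ∑[ v < n ] edge t v) ≡⟨ sum-cong-≗ (λ t → cong (inT t *_) (sym (∣tabulate∣≡∑toℕ (adj t)))) ⟩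
    ∑[ t < n ] (inT t * degree G t)          ∎
    where open ≡-Reasoning

  δ*∣T∣≤∑degreeIn : ∀ δ → (∀ v → δ ≤ degree G v) → δ * ∣ T ∣ ≤ ∑[ v < n ] degreeIn v
  δ*∣T∣≤∑degreeIn δ δ≤degree = begin
    δ * ∣ T ∣                         ≡⟨ cong (δ *_) (∣p∣≡∑toℕ T) ⟩
    δ * ∑[ t < n ] inT t              ≡⟨ *-distribˡ-sum δ inT ⟩
    ∑[ t < n ] (δ * inT t)            ≡⟨ sum-cong-≗ (λ t → *-comm δ (inT t)) ⟩
    ∑[ t < n ] (inT t * δ)            ≤⟨ ∑-mono-≤ (λ t → *-monoʳ-≤ (inT t) (δ≤degree t)) ⟩
    ∑[ t < n ] (inT t * degree G t)   ≡⟨ sym ∑degreeIn≡∑inT*degree ⟩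
    ∑[ v < n ] degreeIn v             ∎
    where open ≤-Reasoning

  module _ (atMostOne : ∀ v → degreeIn v ≤ 1) where

    ∑degreeIn+∣T∣≤n+innerDegreeSum : ∑[ v < n ] degreeIn v + ∣ T ∣ ≤ n + innerDegreeSum
    ∑degreeIn+∣T∣≤n+innerDegreeSum = begin
      ∑[ v < n ] degreeIn v + ∣ T ∣                    ≡⟨ cong (∑[ v < n ] degreeIn v +_) (∣p∣≡∑toℕ T) ⟩
      ∑[ v < n ] degreeIn v + ∑[ v < n ] inT v         ≡⟨ ∑-distrib-+ degreeIn inT ⟨
      ∑[ v < n ] (degreeIn v + inT v)                  ≤⟨ ∑-mono-≤ (λ v → x+toℕb≤1+toℕb*x (lookup T v) (atMostOne v)) ⟩
      ∑[ v < n ] (1 + inT v * degreeIn v)              ≡⟨ ∑-distrib-+ (λ _ → 1) (λ v → inT v * degreeIn v) ⟩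
      ∑[ v < n ] 1 + innerDegreeSum                    ≡⟨ cong (_+ innerDegreeSum) (∑-one n) ⟩
      n + innerDegreeSum                               ∎
      where open ≤-Reasoning

    innerDegreeSum≤∣T∣ : innerDegreeSum ≤ ∣ T ∣
    innerDegreeSum≤∣T∣ = begin
      ∑[ v < n ] (inT v * degreeIn v)   ≤⟨ ∑-mono-≤ (λ v → *-monoʳ-≤ (inT v) (atMostOne v)) ⟩
      ∑[ v < n ] (inT v * 1)            ≡⟨ sum-cong-≗ (λ v → *-identityʳ (inT v)) ⟩
      ∑[ v < n ] inT v                  ≡⟨ ∣p∣≡∑toℕ T ⟨
      ∣ T ∣                             ∎
      where open ≤-Reasoning

  2∣innerDegreeSum : 2 ∣ innerDegreeSum
  2∣innerDegreeSum =
    subst (2 ∣_) (sym (sum-cong-≗ (λ v → *-distribˡ-sum (inT v) (λ t → inT t * edge t v))))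
      (2∣∑-symmetric a a-symmetric a-diagonal)
    where
    a : Fin n → Fin n → ℕ
    a v t = inT v * (inT t * edge t v)
    a-symmetric : ∀ v t → a v t ≡ a t v
    a-symmetric v t = begin
      inT v * (inT t * edge t v)   ≡⟨ *-assoc (inT v) (inT t) (edge t v) ⟨
      inT v * inT t * edge t v     ≡⟨ cong₂ _*_ (*-comm (inT v) (inT t)) (cong toℕ (adj-sym t v)) ⟩
      inT t * inT v * edge v t     ≡⟨ *-assoc (inT t) (inT v) (edge v t) ⟩
      inT t * (inT v * edge v t)   ∎
      where open ≡-Reasoning
    a-diagonal : ∀ v → a v v ≡ 0
    a-diagonal v rewrite irrefl v | *-zeroʳ (inT v) = *-zeroʳ (inT v)

lemma3p4 : (n : ℕ) (G : Graph n) (δ : ℕ) → MinDegree G δ → TriangleFree G →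
    (T : Subset n) → NoDist2 G T → 2 * ⌈ δ * ∣ T ∣ /2⌉ ≤ n
lemma3p4 n G δ (δ≤degree , _) triangleFree T noDist2 =
  2*⌈δt/2⌉≤n δ ∣ T ∣ (innerDegreeSum G T) n
    (≤-trans (+-monoˡ-≤ ∣ T ∣ (δ*∣T∣≤∑degreeIn G T δ δ≤degree))
             (∑degreeIn+∣T∣≤n+innerDegreeSum G T atMostOne))
    (innerDegreeSum≤∣T∣ G T atMostOne)
    (2∣innerDegreeSum G T)
  where
  atMostOne : ∀ v → degreeIn G T v ≤ 1
  atMostOne = degreeIn≤1 G T triangleFree noDist2
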